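{- Let $D$ be a discrete set equipped with a linear order $\le_D$. Then the approximate lexicographic order $(\le^\varepsilon_{D^{\mathbb{N}}})_{\varepsilon\in\mathbb{N}}$ is an approximate linear preorder on the discrete-sequence closeness space $D^{\mathbb{N}}$.
   Context: Constructive type theory with function extensionality. A type is discrete if equality on it is decidable; a set is a type whose identity types are propositions. A linear order is a proposition-valued relation that is reflexive, transitive, antisymmetric and linear (for all $x,y$, one can decide which of $x\le y$ or $y\le x$ holds). For $\alpha,\beta:\mathbb{N}\to D$, $\alpha\sim^n\beta$ means $\alpha_i=\beta_i$ for all $i<n$. $\mathbb{N}_\infty$: decreasing binary sequences; $\underline{n}$: $n$ ones then zeros; $u\preceq v$ iff $\forall n(u_n=1\Rightarrow v_n=1)$. The discrete-sequence closeness function $c:D^{\mathbb{N}}\to D^{\mathbb{N}}\to\mathbb{N}_\infty$ is $c(\alpha,\beta)_n=1$ if $\alpha\sim^{n+1}\beta$ and $0$ otherwise; $C_\varepsilon(\alpha,\beta)$ means $\underline{\varepsilon}\preceq c(\alpha,\beta)$. The approximate lexicographic order is $\alpha\le^\varepsilon_{D^{\mathbb{N}}}\beta$ iff for all $n<\varepsilon$, $\alpha\sim^n\beta$ implies $\alpha_n\le_D\beta_n$. An approximate linear preorder on a closeness space $Y$ is a family of proposition-valued relations $\le^\varepsilon$ such that each $\le^\varepsilon$ is reflexive, transitive, linear, decidable, and $C_\varepsilon(x,y)\Rightarrow x\le^\varepsilon y$. -}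

module Defs where

open import Level using (Level; _⊔_)
open import Data.Bool using (Bool; true; false; _∧_; T)
open import Data.Bool.Properties using (∧-zeroʳ)
open import Data.Nat using (ℕ; zero; suc; _<_; _<ᵇ_)
open import Data.Product using (Σ; _,_; proj₁)
open import Data.Sum using (_⊎_)
open import Relation.Nullary using (Dec; ¬_; does)
open import Relation.Binary.Definitions using (DecidableEquality)
open import Relation.Binary.PropositionalEquality using (_≡_; refl)

private variable a b ℓ : Level

isProp : Set a → Set a
isProp A = (x y : A) → x ≡ y

record IsLinearOrder {D : Set a} (_≤_ : D → D → Set b) : Set (a ⊔ b) where
  field
    prop-valued : ∀ x y → isProp (x ≤ y)
    reflexive   : ∀ x → x ≤ x
    transitive  : ∀ x y z → x ≤ y → y ≤ z → x ≤ z
    antisym     : ∀ x y → x ≤ y → y ≤ x → x ≡ y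
    linear      : ∀ x y → (x ≤ y) ⊎ (y ≤ x)

-- ℕ∞ : decreasing binary sequences (true = 1, false = 0).
is-decreasing : (ℕ → Bool) → Set
is-decreasing u = ∀ n → u (suc n) ≡ true → u n ≡ true

ℕ∞ : Set
ℕ∞ = Σ (ℕ → Bool) is-decreasing

<ᵇ-dec : ∀ n i → (suc i <ᵇ n) ≡ true → (i <ᵇ n) ≡ true
<ᵇ-dec (suc zero)    zero    ()
<ᵇ-dec (suc (suc n)) zero    p = refl
<ᵇ-dec (suc (suc n)) (suc i) p = <ᵇ-dec (suc n) i p

ι : ℕ → ℕ∞
ι n = (λ i → i <ᵇ n) , <ᵇ-dec n

_≼_ : ℕ∞ → ℕ∞ → Set
u ≼ v = ∀ n → proj₁ u n ≡ true → proj₁ v n ≡ true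

_∼⟨_⟩_ : {D : Set a} → (ℕ → D) → ℕ → (ℕ → D) → Set a
α ∼⟨ n ⟩ β = ∀ i → i < n → α i ≡ β i

-- Discrete-sequence closeness function c : Dᴺ → Dᴺ → ℕ∞,
-- c(α,β)_n = 1 iff α ∼^{n+1} β (computed by the decision procedure).
module Closeness {D : Set a} (_≟_ : DecidableEquality D) where

  agree : (ℕ → D) → (ℕ → D) → ℕ → Bool
  agree α β zero    = true
  agree α β (suc n) = agree α β n ∧ does (α n ≟ β n)

  agree-dec : ∀ α β n → agree α β (suc (suc n)) ≡ true → agree α β (suc n) ≡ true
  agree-dec α β n p with agree α β (suc n)
  ... | true  = refl
  ... | false = p

  c : (ℕ → D) → (ℕ → D) → ℕ∞
  c α β = (λ n → agree α β (suc n)) , agree-dec α β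

  C : ℕ → (ℕ → D) → (ℕ → D) → Set
  C ε α β = ι ε ≼ c α β

approx-lex : {D : Set a} → (D → D → Set b) → ℕ → (ℕ → D) → (ℕ → D) → Set (a ⊔ b)
approx-lex _≤_ ε α β = ∀ n → n < ε → α ∼⟨ n ⟩ β → α n ≤ β n

record IsApproxLinearPreorder {Y : Set a} (C : ℕ → Y → Y → Set)
         (_≤[_]_ : Y → ℕ → Y → Set b) : Set (a ⊔ b) where
  field
    prop-valued : ∀ ε x y → isProp (x ≤[ ε ] y)
    reflexive   : ∀ ε x → x ≤[ ε ] x
    transitive  : ∀ ε x y z → x ≤[ ε ] y → y ≤[ ε ] z → x ≤[ ε ] z
    linear      : ∀ ε x y → (x ≤[ ε ] y) ⊎ (y ≤[ ε ] x)
    decidable   : ∀ ε x y → Dec (x ≤[ ε ] y)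
    close⇒≤     : ∀ ε x y → C ε x y → x ≤[ ε ] y

-- Two sequences that do not agree up to ε have a first index m < ε where they
-- differ, and by the agreement below m the approximate lexicographic order at
-- level ε then amounts to α m ≤ β m. Linearity and decidability are thereby
-- inherited from ≤_D, transitivity follows from antisymmetry of ≤_D, and
-- sequences that agree up to ε are related in both directions.
module Submission where

open import Defs
open import Level using (Level; 0ℓ; _⊔_)
open import Data.Bool using (true)
open import Data.Bool.Properties using (∧-zeroʳ; T-≡)
open import Data.Nat using (ℕ; zero; suc; _<_)
open import Data.Nat.Properties using (<-trans; <-cmp; n<1+n; m<1+n⇒m<n∨m≡n; <⇒<ᵇ)
open import Data.Sum using (_⊎_; inj₁; inj₂)
open import Function.Bundles using (_⇔_; mk⇔; Equivalence)
open import Relation.Nullary using (Dec; yes; no; contradiction)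
open import Relation.Nullary.Decidable using (map)
open import Relation.Binary using (tri<; tri≈; tri>)
open import Relation.Binary.Definitions using (DecidableEquality)
open import Relation.Binary.PropositionalEquality using (_≡_; _≢_; refl; sym; trans; subst)
open import Axiom.Extensionality.Propositional using (Extensionality; lower-extensionality)

private variable
  a b : Level
  D : Set a
  α β γ : ℕ → D
  m n : ℕ

∼-sym : α ∼⟨ n ⟩ β → β ∼⟨ n ⟩ α
∼-sym α∼β i i<n = sym (α∼β i i<n)

∼-trans : α ∼⟨ n ⟩ β → β ∼⟨ n ⟩ γ → α ∼⟨ n ⟩ γ
∼-trans α∼β β∼γ i i<n = trans (α∼β i i<n) (β∼γ i i<n)

∼-mono : m < n → α ∼⟨ n ⟩ β → α ∼⟨ m ⟩ β
∼-mono m<n α∼β i i<m = α∼β i (<-trans i<m m<n)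

∼-extend : α ∼⟨ n ⟩ β → α n ≡ β n → α ∼⟨ suc n ⟩ β
∼-extend {n = n} α∼β αn≡βn i i<1+n with m<1+n⇒m<n∨m≡n i<1+n
... | inj₁ i<n  = α∼β i i<n
... | inj₂ refl = αn≡βn

record FirstDifferenceBelow {D : Set a} (n : ℕ) (α β : ℕ → D) : Set a where
  field
    index        : ℕ
    index<n      : index < n
    agree-before : α ∼⟨ index ⟩ β
    differ       : α index ≢ β index

FirstDifferenceBelow-sym : FirstDifferenceBelow n α β → FirstDifferenceBelow n β α
FirstDifferenceBelow-sym d = record
  { index        = index
  ; index<n      = index<n
  ; agree-before = ∼-sym agree-before
  ; differ       = λ βm≡αm → differ (sym βm≡αm)
  }
  where open FirstDifferenceBelow d

FirstDifferenceBelow-weaken : m < n → FirstDifferenceBelow m α β → FirstDifferenceBelow n α β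
FirstDifferenceBelow-weaken m<n d = record
  { index        = index
  ; index<n      = <-trans index<n m<n
  ; agree-before = agree-before
  ; differ       = differ
  }
  where open FirstDifferenceBelow d

module _ {D : Set a} (_≟_ : DecidableEquality D) where

  ∼-or-firstDifference : (α β : ℕ → D) (n : ℕ) → α ∼⟨ n ⟩ β ⊎ FirstDifferenceBelow n α β
  ∼-or-firstDifference α β zero = inj₁ λ i ()
  ∼-or-firstDifference α β (suc n) with ∼-or-firstDifference α β n
  ... | inj₂ d = inj₂ (FirstDifferenceBelow-weaken (n<1+n n) d)
  ... | inj₁ α∼β with α n ≟ β n
  ...   | yes αn≡βn = inj₁ (∼-extend α∼β αn≡βn)
  ...   | no αn≢βn  = inj₂ record
    { index = n ; index<n = n<1+n n ; agree-before = α∼β ; differ = αn≢βn }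

  open Closeness _≟_

  agree⇒≡ : (α β : ℕ → D) (n : ℕ) → agree α β (suc n) ≡ true → α n ≡ β n
  agree⇒≡ α β n agreed with α n ≟ β n
  ... | yes αn≡βn = αn≡βn
  ... | no _      = contradiction (trans (sym (∧-zeroʳ (agree α β n))) agreed) λ ()

  C⇒∼ : ∀ ε (α β : ℕ → D) → C ε α β → α ∼⟨ ε ⟩ β
  C⇒∼ ε α β close i i<ε = agree⇒≡ α β i (close i (Equivalence.to T-≡ (<⇒<ᵇ i<ε)))

module _ {D : Set a} {_≤_ : D → D → Set b} (L : IsLinearOrder _≤_) where

  open IsLinearOrder L

  ≡⇒≤ : {x y : D} → x ≡ y → x ≤ y
  ≡⇒≤ {x} refl = reflexive x

  linear⇒decidable : DecidableEquality D → (x y : D) → Dec (x ≤ y)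
  linear⇒decidable _≟_ x y with linear x y
  ... | inj₁ x≤y = yes x≤y
  ... | inj₂ y≤x with x ≟ y
  ...   | yes x≡y = yes (≡⇒≤ x≡y)
  ...   | no x≢y  = no λ x≤y → x≢y (antisym x y x≤y y≤x)

  approx-lex-isProp : Extensionality a (a ⊔ b) → ∀ ε (α β : ℕ → D) → isProp (approx-lex _≤_ ε α β)
  approx-lex-isProp ext ε α β f g =
    ext₀ λ n → ext₀ λ n<ε → extₐ λ α∼β → prop-valued (α n) (β n) (f n n<ε α∼β) (g n n<ε α∼β)
    where
    ext₀ : Extensionality 0ℓ (a ⊔ b)
    ext₀ = lower-extensionality a 0ℓ ext
    extₐ : Extensionality a b
    extₐ = lower-extensionality 0ℓ a ext

  ∼⇒approx-lex : ∀ {ε} {α β : ℕ → D} → α ∼⟨ ε ⟩ β → approx-lex _≤_ ε α β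
  ∼⇒approx-lex α∼β n n<ε _ = ≡⇒≤ (α∼β n n<ε)

  ≤-at-firstDifference⇔approx-lex : ∀ {ε} {α β : ℕ → D} (d : FirstDifferenceBelow ε α β) →
    let m = FirstDifferenceBelow.index d in α m ≤ β m ⇔ approx-lex _≤_ ε α β
  ≤-at-firstDifference⇔approx-lex {α = α} {β} d = mk⇔ to (λ f → f index index<n agree-before)
    where
    open FirstDifferenceBelow d
    to : α index ≤ β index → approx-lex _≤_ _ α β
    to αm≤βm n n<ε α∼β with <-cmp n index
    ... | tri< n<m _ _ = ≡⇒≤ (agree-before n n<m)
    ... | tri≈ _ refl _ = αm≤βm
    ... | tri> _ _ m<n = contradiction (α∼β index m<n) differ

  module _ (_≟_ : DecidableEquality D) where

    approx-lex-trans : ∀ ε (α β γ : ℕ → D) →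
      approx-lex _≤_ ε α β → approx-lex _≤_ ε β γ → approx-lex _≤_ ε α γ
    approx-lex-trans ε α β γ f g n n<ε α∼γ with ∼-or-firstDifference _≟_ α β n
    ... | inj₁ α∼β = transitive _ _ _ (f n n<ε α∼β) (g n n<ε (∼-trans (∼-sym α∼β) α∼γ))
    ... | inj₂ d = contradiction (antisym _ _ αm≤βm βm≤αm) differ
      where
      open FirstDifferenceBelow d
      m<ε = <-trans index<n n<ε
      αm≤βm = f index m<ε agree-before
      β∼γ = ∼-trans (∼-sym agree-before) (∼-mono index<n α∼γ)
      βm≤αm = subst (β index ≤_) (sym (α∼γ index index<n)) (g index m<ε β∼γ)

    approx-lex-linear : ∀ ε (α β : ℕ → D) → approx-lex _≤_ ε α β ⊎ approx-lex _≤_ ε β α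
    approx-lex-linear ε α β with ∼-or-firstDifference _≟_ α β ε
    ... | inj₁ α∼β = inj₁ (∼⇒approx-lex α∼β)
    ... | inj₂ d with linear (α index) (β index)
      where open FirstDifferenceBelow d
    ...   | inj₁ αm≤βm = inj₁ (Equivalence.to (≤-at-firstDifference⇔approx-lex d) αm≤βm)
    ...   | inj₂ βm≤αm =
      inj₂ (Equivalence.to (≤-at-firstDifference⇔approx-lex (FirstDifferenceBelow-sym d)) βm≤αm)

    approx-lex-decidable : ∀ ε (α β : ℕ → D) → Dec (approx-lex _≤_ ε α β)
    approx-lex-decidable ε α β with ∼-or-firstDifference _≟_ α β ε
    ... | inj₁ α∼β = yes (∼⇒approx-lex α∼β)
    ... | inj₂ d = map (≤-at-firstDifference⇔approx-lex d) (linear⇒decidable _≟_ _ _)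

lemma4p17 : {a b : Level} → Extensionality a (Level._⊔_ a b)
    → {D : Set a} (_≟_ : DecidableEquality D) (_≤_ : D → D → Set b)
    → IsLinearOrder _≤_
    → IsApproxLinearPreorder (Closeness.C _≟_) (λ α ε β → approx-lex _≤_ ε α β)
lemma4p17 ext _≟_ _≤_ L = record
  { prop-valued = approx-lex-isProp L ext
  ; reflexive   = λ ε α → ∼⇒approx-lex L {ε} {α} λ _ _ → refl
  ; transitive  = approx-lex-trans L _≟_
  ; linear      = approx-lex-linear L _≟_
  ; decidable   = approx-lex-decidable L _≟_
  ; close⇒≤     = λ ε α β close → ∼⇒approx-lex L (C⇒∼ _≟_ ε α β close)
  }
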